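{- Let $i\ge1$, $1\le k\le5$ and $1\le j\le6$. Then $$\Sigma_i\big(I_k^{(i+2)}C_j(i)\big)=I_{k'}^{(i)}C_{j'}(i+1)$$ for some $1\le k'\le5$ and $1\le j'\le6$.
   Context: Words are finite sequences of integers. For a word $w$ and letters $a,b=a+1$ such that the subword of $w$ on $\{a,b\}$ has letter counts $(2,1)$ or $(1,2)$: $\sigma_a$ replaces that subword via $aab\leftrightarrow abb$, $aba\leftrightarrow bba$, $baa\leftrightarrow bab$, and $\bar\sigma_a$ replaces it via $aab\leftrightarrow bab$, $aba\leftrightarrow abb$, $baa\leftrightarrow bba$, all other letters unchanged. Products act right to left. On pairs of words, $\Sigma_i(w_1,w_2)=(\bar\sigma_i\sigma_{i+1}w_1,\ \sigma_i\bar\sigma_{i+1}w_2)$. With $b=a+1$: $C_1(a)=(aabb,baab)$, $C_2(a)=(abab,abab)$, $C_3(a)=(abba,aabb)$, $C_4(a)=(baab,bbaa)$, $C_5(a)=(baba,baba)$, $C_6(a)=(bbaa,abba)$. $I_k^{(a)}w_1\cdots w_n=w_1\cdots w_{k-1}\,a\,w_k\cdots w_n$ (so $I_1^{(a)}w=aw$, $I_{n+1}^{(a)}w=wa$), acting on pairs componentwise. -}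

module Defs where

open import Data.Nat using (ℕ; zero; suc; _∸_; _≟_)
open import Data.List using (List; []; _∷_; take; drop; _++_)
open import Data.Maybe using (Maybe; just; nothing; _>>=_)
open import Data.Product using (_×_; _,_)
open import Relation.Nullary using (yes; no)

-- Words: finite sequences of letters. All letters occurring in the statement
-- are ≥ 1, so letters are taken in ℕ.
Word : Set
Word = List ℕ

-- The two letters a and b = a+1 of the restricted subword.
data AB : Set where
  A B : AB

classify : ℕ → ℕ → Maybe AB
classify a x with x ≟ a
... | yes _ = just A
... | no _ with x ≟ suc a
...   | yes _ = just B
...   | no _  = nothing

subword : ℕ → Word → List AB
subword a [] = []
subword a (x ∷ w) with classify a x
... | just l  = l ∷ subword a w
... | nothing = subword a w

letter : ℕ → AB → ℕ
letter a A = a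
letter a B = suc a

refill : ℕ → Word → List AB → Word
refill a [] ls = []
refill a (x ∷ w) ls with classify a x
refill a (x ∷ w) [] | just _ = x ∷ refill a w []
refill a (x ∷ w) (l ∷ ls) | just _ = letter a l ∷ refill a w ls
refill a (x ∷ w) ls | nothing = x ∷ refill a w ls

σ-sub : List AB → Maybe (List AB)
σ-sub (A ∷ A ∷ B ∷ []) = just (A ∷ B ∷ B ∷ [])
σ-sub (A ∷ B ∷ B ∷ []) = just (A ∷ A ∷ B ∷ [])
σ-sub (A ∷ B ∷ A ∷ []) = just (B ∷ B ∷ A ∷ [])
σ-sub (B ∷ B ∷ A ∷ []) = just (A ∷ B ∷ A ∷ [])
σ-sub (B ∷ A ∷ A ∷ []) = just (B ∷ A ∷ B ∷ [])
σ-sub (B ∷ A ∷ B ∷ []) = just (B ∷ A ∷ A ∷ [])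
σ-sub _ = nothing

σ̄-sub : List AB → Maybe (List AB)
σ̄-sub (A ∷ A ∷ B ∷ []) = just (B ∷ A ∷ B ∷ [])
σ̄-sub (B ∷ A ∷ B ∷ []) = just (A ∷ A ∷ B ∷ [])
σ̄-sub (A ∷ B ∷ A ∷ []) = just (A ∷ B ∷ B ∷ [])
σ̄-sub (A ∷ B ∷ B ∷ []) = just (A ∷ B ∷ A ∷ [])
σ̄-sub (B ∷ A ∷ A ∷ []) = just (B ∷ B ∷ A ∷ [])
σ̄-sub (B ∷ B ∷ A ∷ []) = just (B ∷ A ∷ A ∷ [])
σ̄-sub _ = nothing

σ : ℕ → Word → Maybe Word
σ a w = σ-sub (subword a w) >>= λ s → just (refill a w s)

σ̄ : ℕ → Word → Maybe Word
σ̄ a w = σ̄-sub (subword a w) >>= λ s → just (refill a w s)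

-- Σ_i(w₁,w₂) = (σ̄_i σ_{i+1} w₁, σ_i σ̄_{i+1} w₂), products acting right to left
Σ : ℕ → Word × Word → Maybe (Word × Word)
Σ i (w₁ , w₂) =
  (σ (suc i) w₁ >>= σ̄ i) >>= λ u₁ →
  (σ̄ (suc i) w₂ >>= σ i) >>= λ u₂ →
  just (u₁ , u₂)

-- C_j(a), j = 1..6 (b = a + 1); other indices are never used
C : ℕ → ℕ → Word × Word
C 1 a = (a ∷ a ∷ b ∷ b ∷ [] , b ∷ a ∷ a ∷ b ∷ []) where b = suc a
C 2 a = (a ∷ b ∷ a ∷ b ∷ [] , a ∷ b ∷ a ∷ b ∷ []) where b = suc a
C 3 a = (a ∷ b ∷ b ∷ a ∷ [] , a ∷ a ∷ b ∷ b ∷ []) where b = suc a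
C 4 a = (b ∷ a ∷ a ∷ b ∷ [] , b ∷ b ∷ a ∷ a ∷ []) where b = suc a
C 5 a = (b ∷ a ∷ b ∷ a ∷ [] , b ∷ a ∷ b ∷ a ∷ []) where b = suc a
C 6 a = (b ∷ b ∷ a ∷ a ∷ [] , a ∷ b ∷ b ∷ a ∷ []) where b = suc a
C _ a = ([] , [])

-- I_k^{(a)} w = w₁⋯w_{k-1} a w_k⋯w_n  (k is 1-based)
I : ℕ → ℕ → Word → Word
I k a w = take (k ∸ 1) w ++ a ∷ drop (k ∸ 1) w

I² : ℕ → ℕ → Word × Word → Word × Word
I² k a (w₁ , w₂) = (I k a w₁ , I k a w₂)

-- Every ingredient (classifying letters, σ, σ̄, Σ, C_j, I_k) commutes with adding 1 to all
-- letters of a word, so the instance at i is the instance at i = 0 shifted by i.  That instance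
-- involves only the letters 0, 1, 2 and is settled by computing Σ on the 30 words I_k^(2) C_j(0).
{-# OPTIONS --safe #-}
module Submission where

open import Defs
open import Data.Nat using (ℕ; zero; suc; _≤_; _+_; _∸_; _≟_; _≤?_; s≤s)
open import Data.Nat.Properties using (suc-injective; ≡-irrelevant)
open import Data.List using (List; []; _∷_; map; take; drop; _++_)
open import Data.List.Properties using (take-map; drop-map; map-++)
open import Data.Maybe using (Maybe; just; nothing; _>>=_)
import Data.Maybe as Maybe
open import Data.Product using (Σ-syntax; _×_; _,_)
open import Function using (_∘_)
open import Relation.Binary.PropositionalEquality using (_≡_; refl; sym; cong; cong₂; module ≡-Reasoning)
open import Relation.Nullary using (yes; no)
open import Relation.Nullary.Decidable using (True; toWitness; dec-yes-irr; dec-no)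

shift : Word → Word
shift = map suc

shift² : Word × Word → Word × Word
shift² (u , v) = (shift u , shift v)

classify-suc : ∀ a x → classify (suc a) (suc x) ≡ classify a x
classify-suc a x with x ≟ a
... | yes refl rewrite dec-yes-irr (suc x ≟ suc x) ≡-irrelevant refl = refl
... | no x≢a rewrite dec-no (suc x ≟ suc a) (x≢a ∘ suc-injective) with x ≟ suc a
...   | yes refl rewrite dec-yes-irr (suc x ≟ suc x) ≡-irrelevant refl = refl
...   | no x≢1+a rewrite dec-no (suc x ≟ suc (suc a)) (x≢1+a ∘ suc-injective) = refl

subword-shift : ∀ a w → subword (suc a) (shift w) ≡ subword a w
subword-shift a [] = refl
subword-shift a (x ∷ w) rewrite classify-suc a x with classify a x
... | just l  = cong (l ∷_) (subword-shift a w)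
... | nothing = subword-shift a w

refill-shift : ∀ a w ls → refill (suc a) (shift w) ls ≡ shift (refill a w ls)
refill-shift a [] ls = refl
refill-shift a (x ∷ w) ls rewrite classify-suc a x with classify a x
refill-shift a (x ∷ w) []       | just _  = cong (suc x ∷_) (refill-shift a w [])
refill-shift a (x ∷ w) (A ∷ ls) | just _  = cong (suc a ∷_) (refill-shift a w ls)
refill-shift a (x ∷ w) (B ∷ ls) | just _  = cong (suc (suc a) ∷_) (refill-shift a w ls)
refill-shift a (x ∷ w) ls       | nothing = cong (suc x ∷_) (refill-shift a w ls)

-- σ and σ̄ unfold to rewriteSubword σ-sub and rewriteSubword σ̄-sub.
rewriteSubword : (List AB → Maybe (List AB)) → ℕ → Word → Maybe Word
rewriteSubword r a w = r (subword a w) >>= λ s → just (refill a w s)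

CommutesWithShift : (ℕ → Word → Maybe Word) → Set
CommutesWithShift f = ∀ a w → f (suc a) (shift w) ≡ Maybe.map shift (f a w)

rewriteSubword-commutesWithShift : ∀ r → CommutesWithShift (rewriteSubword r)
rewriteSubword-commutesWithShift r a w rewrite subword-shift a w with r (subword a w)
... | just s  = cong just (refill-shift a w s)
... | nothing = refl

σ-commutesWithShift : CommutesWithShift σ
σ-commutesWithShift = rewriteSubword-commutesWithShift σ-sub

σ̄-commutesWithShift : CommutesWithShift σ̄
σ̄-commutesWithShift = rewriteSubword-commutesWithShift σ̄-sub

>>=-commutesWithShift : ∀ f g → CommutesWithShift f → CommutesWithShift g →
  ∀ a w → (f (suc (suc a)) (shift w) >>= g (suc a)) ≡ Maybe.map shift (f (suc a) w >>= g a)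
>>=-commutesWithShift f g f-shift g-shift a w rewrite f-shift (suc a) w with f (suc a) w
... | just u  = g-shift a u
... | nothing = refl

pairUp : Maybe Word → Maybe Word → Maybe (Word × Word)
pairUp m₁ m₂ = m₁ >>= λ u₁ → m₂ >>= λ u₂ → just (u₁ , u₂)

pairUp-shift : ∀ m₁ m₂ → pairUp (Maybe.map shift m₁) (Maybe.map shift m₂) ≡ Maybe.map shift² (pairUp m₁ m₂)
pairUp-shift nothing   _         = refl
pairUp-shift (just _)  nothing   = refl
pairUp-shift (just _)  (just _)  = refl

Σ-shift : ∀ a p → Σ (suc a) (shift² p) ≡ Maybe.map shift² (Σ a p)
Σ-shift a (u , v) = begin
  pairUp (σ (suc (suc a)) (shift u) >>= σ̄ (suc a)) (σ̄ (suc (suc a)) (shift v) >>= σ (suc a))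
    ≡⟨ cong₂ pairUp (>>=-commutesWithShift σ σ̄ σ-commutesWithShift σ̄-commutesWithShift a u)
                    (>>=-commutesWithShift σ̄ σ σ̄-commutesWithShift σ-commutesWithShift a v) ⟩
  pairUp (Maybe.map shift (σ (suc a) u >>= σ̄ a)) (Maybe.map shift (σ̄ (suc a) v >>= σ a))
    ≡⟨ pairUp-shift (σ (suc a) u >>= σ̄ a) (σ̄ (suc a) v >>= σ a) ⟩
  Maybe.map shift² (pairUp (σ (suc a) u >>= σ̄ a) (σ̄ (suc a) v >>= σ a)) ∎
  where open ≡-Reasoning

I-shift : ∀ k a w → I k (suc a) (shift w) ≡ shift (I k a w)
I-shift k a w = begin
  take n (shift w) ++ suc a ∷ drop n (shift w)
    ≡⟨ cong₂ (λ xs ys → xs ++ suc a ∷ ys) (take-map n w) (drop-map n w) ⟩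
  shift (take n w) ++ shift (a ∷ drop n w)
    ≡⟨ sym (map-++ suc (take n w) (a ∷ drop n w)) ⟩
  shift (take n w ++ a ∷ drop n w) ∎
  where
  open ≡-Reasoning
  n = k ∸ 1

I²-shift : ∀ k a p → I² k (suc a) (shift² p) ≡ shift² (I² k a p)
I²-shift k a (u , v) = cong₂ _,_ (I-shift k a u) (I-shift k a v)

C-shift : ∀ j a → C j (suc a) ≡ shift² (C j a)
C-shift 0 a = refl
C-shift 1 a = refl
C-shift 2 a = refl
C-shift 3 a = refl
C-shift 4 a = refl
C-shift 5 a = refl
C-shift 6 a = refl
C-shift (suc (suc (suc (suc (suc (suc (suc _))))))) a = refl

module _ (k j k′ j′ : ℕ) where

  ΣMaps : ℕ → Set
  ΣMaps i = Σ i (I² k (i + 2) (C j i)) ≡ just (I² k′ i (C j′ (i + 1)))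

  ΣMaps-suc : ∀ i → ΣMaps i → ΣMaps (suc i)
  ΣMaps-suc i eq = begin
    Σ (suc i) (I² k (suc (i + 2)) (C j (suc i)))
      ≡⟨ cong (Σ (suc i) ∘ I² k (suc (i + 2))) (C-shift j i) ⟩
    Σ (suc i) (I² k (suc (i + 2)) (shift² (C j i)))
      ≡⟨ cong (Σ (suc i)) (I²-shift k (i + 2) (C j i)) ⟩
    Σ (suc i) (shift² (I² k (i + 2) (C j i)))
      ≡⟨ Σ-shift i (I² k (i + 2) (C j i)) ⟩
    Maybe.map shift² (Σ i (I² k (i + 2) (C j i)))
      ≡⟨ cong (Maybe.map shift²) eq ⟩
    just (shift² (I² k′ i (C j′ (i + 1))))
      ≡⟨ cong just (sym (I²-shift k′ i (C j′ (i + 1)))) ⟩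
    just (I² k′ (suc i) (shift² (C j′ (i + 1))))
      ≡⟨ cong (just ∘ I² k′ (suc i)) (sym (C-shift j′ (i + 1))) ⟩
    just (I² k′ (suc i) (C j′ (suc i + 1))) ∎
    where open ≡-Reasoning

  ΣMaps-from-0 : ∀ i → ΣMaps 0 → ΣMaps i
  ΣMaps-from-0 zero    eq = eq
  ΣMaps-from-0 (suc i) eq = ΣMaps-suc i (ΣMaps-from-0 i eq)

ΣImage : (i k j : ℕ) → Set
ΣImage i k j = Σ[ k′ ∈ ℕ ] Σ[ j′ ∈ ℕ ] ((1 ≤ k′ × k′ ≤ 5) × (1 ≤ j′ × j′ ≤ 6) × ΣMaps k j k′ j′ i)

ΣImage-from-0 : ∀ i k j → ΣImage 0 k j → ΣImage i k j
ΣImage-from-0 i k j (k′ , j′ , k′-bounds , j′-bounds , eq) =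
  k′ , j′ , k′-bounds , j′-bounds , ΣMaps-from-0 k j k′ j′ i eq

ΣImage-entry : ∀ k j k′ j′ {_ : True (1 ≤? k′)} {_ : True (k′ ≤? 5)} {_ : True (1 ≤? j′)} {_ : True (j′ ≤? 6)} →
  ΣMaps k j k′ j′ 0 → ΣImage 0 k j
ΣImage-entry _ _ k′ j′ {1≤k′} {k′≤5} {1≤j′} {j′≤6} eq =
  k′ , j′ , (toWitness 1≤k′ , toWitness k′≤5) , (toWitness 1≤j′ , toWitness j′≤6) , eq

ΣImage-0 : ∀ k j → 1 ≤ k → k ≤ 5 → 1 ≤ j → j ≤ 6 → ΣImage 0 k j
ΣImage-0 1 1 _ _ _ _ = ΣImage-entry 1 1 3 4 refl
ΣImage-0 1 2 _ _ _ _ = ΣImage-entry 1 2 2 4 refl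
ΣImage-0 1 3 _ _ _ _ = ΣImage-entry 1 3 2 5 refl
ΣImage-0 1 4 _ _ _ _ = ΣImage-entry 1 4 4 4 refl
ΣImage-0 1 5 _ _ _ _ = ΣImage-entry 1 5 5 4 refl
ΣImage-0 1 6 _ _ _ _ = ΣImage-entry 1 6 5 5 refl
ΣImage-0 2 1 _ _ _ _ = ΣImage-entry 2 1 3 2 refl
ΣImage-0 2 2 _ _ _ _ = ΣImage-entry 2 2 1 4 refl
ΣImage-0 2 3 _ _ _ _ = ΣImage-entry 2 3 1 5 refl
ΣImage-0 2 4 _ _ _ _ = ΣImage-entry 2 4 4 6 refl
ΣImage-0 2 5 _ _ _ _ = ΣImage-entry 2 5 3 6 refl
ΣImage-0 2 6 _ _ _ _ = ΣImage-entry 2 6 5 6 refl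
ΣImage-0 3 1 _ _ _ _ = ΣImage-entry 3 1 2 2 refl
ΣImage-0 3 2 _ _ _ _ = ΣImage-entry 3 2 4 3 refl
ΣImage-0 3 3 _ _ _ _ = ΣImage-entry 3 3 1 6 refl
ΣImage-0 3 4 _ _ _ _ = ΣImage-entry 3 4 4 5 refl
ΣImage-0 3 5 _ _ _ _ = ΣImage-entry 3 5 2 6 refl
ΣImage-0 3 6 _ _ _ _ = ΣImage-entry 3 6 5 3 refl
ΣImage-0 4 1 _ _ _ _ = ΣImage-entry 4 1 2 3 refl
ΣImage-0 4 2 _ _ _ _ = ΣImage-entry 4 2 3 3 refl
ΣImage-0 4 3 _ _ _ _ = ΣImage-entry 4 3 1 3 refl
ΣImage-0 4 4 _ _ _ _ = ΣImage-entry 4 4 3 5 refl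
ΣImage-0 4 5 _ _ _ _ = ΣImage-entry 4 5 5 1 refl
ΣImage-0 4 6 _ _ _ _ = ΣImage-entry 4 6 5 2 refl
ΣImage-0 5 1 _ _ _ _ = ΣImage-entry 5 1 2 1 refl
ΣImage-0 5 2 _ _ _ _ = ΣImage-entry 5 2 1 1 refl
ΣImage-0 5 3 _ _ _ _ = ΣImage-entry 5 3 1 2 refl
ΣImage-0 5 4 _ _ _ _ = ΣImage-entry 5 4 3 1 refl
ΣImage-0 5 5 _ _ _ _ = ΣImage-entry 5 5 4 1 refl
ΣImage-0 5 6 _ _ _ _ = ΣImage-entry 5 6 4 2 refl
ΣImage-0 0 _ () _ _ _
ΣImage-0 (suc (suc (suc (suc (suc (suc _)))))) _ _ (s≤s (s≤s (s≤s (s≤s (s≤s ()))))) _ _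
ΣImage-0 _ 0 _ _ () _
ΣImage-0 _ (suc (suc (suc (suc (suc (suc (suc _))))))) _ _ _ (s≤s (s≤s (s≤s (s≤s (s≤s (s≤s ()))))))

lemma17 : (i k j : ℕ) → 1 ≤ i → 1 ≤ k → k ≤ 5 → 1 ≤ j → j ≤ 6 →
    Σ[ k′ ∈ ℕ ] Σ[ j′ ∈ ℕ ] ((1 ≤ k′ × k′ ≤ 5) × (1 ≤ j′ × j′ ≤ 6) ×
      Σ i (I² k (i + 2) (C j i)) ≡ just (I² k′ i (C j′ (i + 1))))
lemma17 i k j _ 1≤k k≤5 1≤j j≤6 = ΣImage-from-0 i k j (ΣImage-0 k j 1≤k k≤5 1≤j j≤6)
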